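{- Let $(p_i)_{i\ge 3}$ and $(q_i)_{i\ge 3}$ be two sequences of arbitrary positive integers, and let $\mathrm{G}_k(n)$ be the generalized Frame–Stewart numbers defined below. Then for every integer $k\ge 3$ and every positive integer $n$, $$\mathrm{G}_k(n) = q\cdot\sum_{j=1}^{n}u^k_j,$$ where $q=\prod_{i=3}^{k}q_i$ and $u^k_j$ is the $j$th term of the sequence $(u^k_j)_{j\ge1}$ of integers $\prod_{i=3}^{k}p_i^{\alpha_i}$ (with $\alpha_i\ge 0$ for all $i$) lined in increasing order.
   Context: The generalized Frame–Stewart numbers are defined by $\mathrm{G}_k(0)=0$ for $k\ge 3$; $\mathrm{G}_3(n)=p_3\cdot\mathrm{G}_3(n-1)+q_3$ for $n\ge1$; and for $k\ge 4$, $n\ge 1$, $$\mathrm{G}_k(n)=\min_{1\le t\le n}\bigl\{p_k\cdot\mathrm{G}_k(n-t)+q_k\cdot\mathrm{G}_{k-1}(t)\bigr\}.$$ The sequence $(u^k_j)_{j\ge1}$ is the list, in nondecreasing order and counted with multiplicity over the exponent tuples $(\alpha_3,\dots,\alpha_k)\in\mathbb{Z}_{\ge0}^{k-2}$, of the numbers $\prod_{i=3}^k p_i^{\alpha_i}$ (e.g. for $(p_3,p_4)=(2,2)$ it begins $1,2,2,4,4,4,8,\dots$; for $(p_3,p_4)=(2,3)$ it begins $1,2,3,4,6,8,9,\dots$). By convention, if $p_{i_0}=1$ for some $3\le i_0\le k$, then $(u^k_j)_{j\ge1}$ is the constant sequence of $1$'s. -}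

module Defs where

open import Data.Nat using (ℕ; zero; suc; _+_; _*_; _∸_; _^_; _≤_; _⊓_)
open import Data.List using (List; []; _∷_; map; upTo)
open import Data.Nat.ListAction using (sum)
open import Data.Vec using (Vec; []; _∷_)
open import Data.Product using (Σ; _×_; ∃)
open import Data.Sum using (_⊎_)
open import Function.Definitions using (Injective; Surjective)
open import Relation.Binary.PropositionalEquality using (_≡_)
open import Relation.Nullary using (¬_)

-- Sequences (p_i)_{i≥3}, (q_i)_{i≥3} are modelled as functions ℕ → ℕ;
-- only the values at i ≥ 3 are ever used.

-- minimum of a list (0 for the empty list; only used on nonempty lists)
minimum : List ℕ → ℕ
minimum [] = 0
minimum (x ∷ []) = x
minimum (x ∷ y ∷ ys) = x ⊓ minimum (y ∷ ys)

headD : List ℕ → ℕ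
headD [] = 0
headD (x ∷ _) = x

-- candidates p·G(n+1-t) + q·g(t) for t = t₀, t₀+1, ...,
-- given the list [G(n), G(n-1), ..., G(0)]
cands : (pk qk : ℕ) (g : ℕ → ℕ) → List ℕ → ℕ → List ℕ
cands pk qk g [] t = []
cands pk qk g (x ∷ xs) t = (pk * x + qk * g t) ∷ cands pk qk g xs (suc t)

-- table pk qk g n = [G(n), G(n-1), ..., G(0)] where
-- G(0) = 0 and G(m) = min_{1≤t≤m} { pk·G(m-t) + qk·g(t) }
table : (pk qk : ℕ) (g : ℕ → ℕ) → ℕ → List ℕ
table pk qk g zero = 0 ∷ []
table pk qk g (suc n) = minimum (cands pk qk g (table pk qk g n) 1) ∷ table pk qk g n

G3 : (p q : ℕ → ℕ) → ℕ → ℕ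
G3 p q zero = 0
G3 p q (suc n) = p 3 * G3 p q n + q 3

-- Generalized Frame–Stewart numbers G p q k n = G_k(n) (meaningful for k ≥ 3;
-- the value for k < 3 is an irrelevant junk value 0).
G : (p q : ℕ → ℕ) → ℕ → ℕ → ℕ
G p q zero n = 0
G p q (suc zero) n = 0
G p q (suc (suc zero)) n = 0
G p q (suc (suc (suc zero))) n = G3 p q n
G p q (suc (suc (suc (suc k)))) n =
  headD (table (p (4 + k)) (q (4 + k)) (G p q (suc (suc (suc k)))) n)

prodFrom : (f : ℕ → ℕ) → ℕ → ℕ → ℕ
prodFrom f a zero = 1
prodFrom f a (suc m) = f a * prodFrom f (suc a) m

prodQ : (q : ℕ → ℕ) → ℕ → ℕ
prodQ q k = prodFrom q 3 (k ∸ 2)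

powProd : (p : ℕ → ℕ) → ℕ → {m : ℕ} → Vec ℕ m → ℕ
powProd p i [] = 1
powProd p i (a ∷ as) = p i ^ a * powProd p (suc i) as

-- exponent tuples (α_3, ..., α_k) are vectors of length k ∸ 2;
-- the number they index is ∏_{i=3}^k p_i^{α_i}
tupleValue : (p : ℕ → ℕ) (k : ℕ) → Vec ℕ (k ∸ 2) → ℕ
tupleValue p k α = powProd p 3 α

-- u : ℕ → ℕ is the sequence (u^k_j)_{j≥1}, shifted to 0-based indexing
-- (u j = u^k_{j+1}).  Either some p_{i0} = 1 with 3 ≤ i0 ≤ k and u is
-- constantly 1 (the paper's convention), or all p_i ≠ 1 (3 ≤ i ≤ k) and u is
-- the nondecreasing listing, with multiplicity, of the values ∏ p_i^{α_i}
-- over all exponent tuples: u = tupleValue ∘ e for a bijection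
-- e : ℕ → ℤ≥0^{k-2} making u nondecreasing.
IsUSeq : (p : ℕ → ℕ) (k : ℕ) (u : ℕ → ℕ) → Set
IsUSeq p k u =
  ((Σ ℕ λ i₀ → 3 ≤ i₀ × i₀ ≤ k × p i₀ ≡ 1) × (∀ j → u j ≡ 1))
  ⊎
  ((∀ i → 3 ≤ i → i ≤ k → ¬ (p i ≡ 1)) ×
   (Σ (ℕ → Vec ℕ (k ∸ 2)) λ e →
      Injective _≡_ _≡_ e × Surjective _≡_ _≡_ e ×
      (∀ j → u j ≡ tupleValue p k (e j)) ×
      (∀ i j → i ≤ j → u i ≤ u j)))

sumFirst : (u : ℕ → ℕ) → ℕ → ℕ
sumFirst u n = sum (map u (upTo n))

module Submission where

-- With unit costs q_i = 1, K_m(n) = G_{3+m}(n) is the least value sum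
-- Σ_{α∈S} ∏_{i=3}^{3+m} p_i^{α_i} over sets S of n distinct exponent tuples of
-- length m+1 (`Levels.lowerBound` and `Levels.attained`).  The induction on m
-- splits a set of tuples by its last exponent: tuples ending in 0 form a set of
-- shorter tuples, the others become a set of the same length after lowering the
-- last exponent, which divides their values by p_{4+m}.  This matches the
-- recurrence G_{4+m}(n) = min_t (p_{4+m}·G_{4+m}(n-t) + G_{3+m}(t)) (`Recurrence`).
-- A least value sum of n distinct tuples is the sum of the n smallest values: the
-- first n terms of a sorted enumeration u (`minimum-sorted`, via
-- `prefixSum-minimal`), or simply n when some p_{i₀} = 1 (`minimum-degenerate`).
-- General costs q_i only contribute the factor ∏ q_i (`G-scale`); theorem1 follows.

open import Defs
open import Data.Nat using (ℕ; zero; suc; _+_; _*_; _∸_; _^_; _≤_; _<_; _⊓_; z≤n; s≤s; z<s; >-nonZero)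
open import Data.Nat.Properties
open import Data.Nat.Induction using (Acc; acc; <-wellFounded; <-rec)
open import Data.Nat.ListAction using (sum)
open import Data.Nat.ListAction.Properties using (sum-++; sum-↭)
open import Data.Nat.Tactic.RingSolver using (solve-∀)
open import Data.Fin using (Fin; zero; suc; toℕ; fromℕ<)
open import Data.Fin.Properties using (toℕ-fromℕ<)
open import Data.List using (List; []; _∷_; _++_; map; upTo; applyUpTo; length)
open import Data.List.Properties using (map-++; map-∘; map-cong; length-++; length-map; length-upTo)
open import Data.List.Extrema ≤-totalOrder using (max; xs≤max)
open import Data.List.Relation.Unary.All as All using (All; _∷_)
open import Data.List.Relation.Unary.All.Properties using (¬Any⇒All¬; ++⁻ˡ)
open import Data.List.Relation.Unary.Any using (here; there)
open import Data.List.Relation.Unary.AllPairs using ([]; _∷_)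
open import Data.List.Relation.Unary.Unique.Propositional using (Unique)
import Data.List.Relation.Unary.Unique.Propositional.Properties as UP
open import Data.List.Relation.Binary.Disjoint.Propositional using (Disjoint)
open import Data.List.Membership.Propositional using (_∈_)
open import Data.List.Membership.Propositional.Properties using (∈-∃++; ∈-map⁻)
open import Data.List.Membership.DecPropositional _≟_ using (_∈?_)
open import Data.List.Relation.Binary.Permutation.Propositional using (_↭_; ↭⇒↭ₛ; ↭-refl; ↭-sym; ↭-trans; prep)
open import Data.List.Relation.Binary.Permutation.Propositional.Properties using (↭-length; shift; All-resp-↭)
import Data.List.Relation.Binary.Permutation.Propositional.Properties as Perm
import Data.List.Relation.Binary.Permutation.Setoid.Properties as PermₛProps
open import Data.Vec using (Vec; []; _∷_; _∷ʳ_; head; replicate; lookup; _[_]≔_)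
open import Data.Vec.Properties using (∷-injective; ∷ʳ-injectiveˡ; lookup∘updateAt)
open import Data.Product as Product using (Σ; ∃; _×_; _,_; proj₁; proj₂)
open import Data.Sum using (_⊎_; inj₁; inj₂)
open import Function using (_∘_; id; const)
open import Function.Definitions using (Injective; Surjective)
open import Relation.Nullary using (yes; no)
open import Relation.Binary.PropositionalEquality

sumBelow : (ℕ → ℕ) → ℕ → ℕ
sumBelow f zero = 0
sumBelow f (suc n) = f 0 + sumBelow (f ∘ suc) n

sumBelow-suc : ∀ f n → sumBelow f (suc n) ≡ sumBelow f n + f n
sumBelow-suc f zero = +-comm (f 0) 0
sumBelow-suc f (suc n) = trans (cong (f 0 +_) (sumBelow-suc (f ∘ suc) n)) (sym (+-assoc (f 0) _ _))

sumFirst≡sumBelow : ∀ u n → sumFirst u n ≡ sumBelow u n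
sumFirst≡sumBelow u n = go id n
  where
  go : ∀ g n → sum (map u (applyUpTo g n)) ≡ sumBelow (u ∘ g) n
  go g zero = refl
  go g (suc n) = cong (u (g 0) +_) (go (g ∘ suc) n)

sumBelow-scale : ∀ c f g → (∀ a → g a ≡ c * f a) → ∀ n → sumBelow g n ≡ c * sumBelow f n
sumBelow-scale c f g g≡cf zero = sym (*-zeroʳ c)
sumBelow-scale c f g g≡cf (suc n) =
  trans (cong₂ _+_ (g≡cf 0) (sumBelow-scale c (f ∘ suc) (g ∘ suc) (g≡cf ∘ suc) n))
        (sym (*-distribˡ-+ c (f 0) _))

sumBelow-ones : ∀ u → (∀ j → u j ≡ 1) → ∀ n → sumBelow u n ≡ n
sumBelow-ones u u≡1 zero = refl
sumBelow-ones u u≡1 (suc n) = cong₂ _+_ (u≡1 0) (sumBelow-ones (u ∘ suc) (u≡1 ∘ suc) n)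

sumMap-++ : ∀ {A : Set} (f : A → ℕ) xs ys → sum (map f (xs ++ ys)) ≡ sum (map f xs) + sum (map f ys)
sumMap-++ f xs ys = trans (cong sum (map-++ f xs ys)) (sum-++ (map f xs) (map f ys))

sumMap-map : ∀ {A B : Set} (f : B → ℕ) (g : A → B) {h : A → ℕ} → (∀ x → f (g x) ≡ h x) →
             ∀ xs → sum (map f (map g xs)) ≡ sum (map h xs)
sumMap-map f g fg≡h xs = cong sum (trans (sym (map-∘ xs)) (map-cong fg≡h xs))

sumMap-scale : ∀ {A : Set} c (f : A → ℕ) xs → sum (map (λ x → c * f x) xs) ≡ c * sum (map f xs)
sumMap-scale c f [] = sym (*-zeroʳ c)
sumMap-scale c f (x ∷ xs) = trans (cong (c * f x +_) (sumMap-scale c f xs)) (sym (*-distribˡ-+ c (f x) _))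

unique-↭ : ∀ {A : Set} {xs ys : List A} → xs ↭ ys → Unique xs → Unique ys
unique-↭ {A} π = PermₛProps.Unique-resp-↭ (setoid A) (↭⇒↭ₛ π)

sumMap-↭ : ∀ {A : Set} (f : A → ℕ) {xs ys : List A} → xs ↭ ys → sum (map f xs) ≡ sum (map f ys)
sumMap-↭ f π = sum-↭ (Perm.map⁺ f π)

Monotone : (ℕ → ℕ) → Set
Monotone f = ∀ i j → i ≤ j → f i ≤ f j

tighten : ∀ {B} {L : List ℕ} → All (B ≢_) L → All (_< suc B) L → All (_< B) L
tighten B∉L L<1+B = All.zipWith (λ (B≢x , x<1+B) → ≤∧≢⇒< (≤-pred x<1+B) (B≢x ∘ sym)) (B∉L , L<1+B)

distinctBelow : ∀ f → Monotone f → ∀ B (L : List ℕ) → Unique L → All (_< B) L →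
                length L ≤ B × sumBelow f (length L) ≤ sum (map f L)
distinctBelow f mono zero [] _ _ = z≤n , z≤n
distinctBelow f mono zero (x ∷ L) _ (() ∷ _)
distinctBelow f mono (suc B) L u L<1+B with B ∈? L
... | no B∉L =
  Product.map₁ m≤n⇒m≤1+n (distinctBelow f mono B L u (tighten (¬Any⇒All¬ L B∉L) L<1+B))
-- If B ∈ L, move it to the front: the other elements are distinct and below B.
... | yes B∈L with ys , zs , refl ← ∈-∃++ B∈L
                with B∉rest ∷ uRest ← unique-↭ (shift B ys zs) u
                rewrite ↭-length (shift B ys zs) | sumMap-↭ f (shift B ys zs) =
  addMax (ys ++ zs) (distinctBelow f mono B (ys ++ zs) uRest
           (tighten B∉rest (All.tail (All-resp-↭ (shift B ys zs) L<1+B))))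
  where
  addMax : ∀ rest → length rest ≤ B × sumBelow f (length rest) ≤ sum (map f rest) →
           suc (length rest) ≤ suc B × sumBelow f (suc (length rest)) ≤ f B + sum (map f rest)
  addMax rest (len , s) = s≤s len , (begin
    sumBelow f (suc (length rest))      ≡⟨ sumBelow-suc f (length rest) ⟩
    sumBelow f (length rest) + f (length rest) ≤⟨ +-mono-≤ s (mono _ _ len) ⟩
    sum (map f rest) + f B              ≡⟨ +-comm (sum (map f rest)) (f B) ⟩
    f B + sum (map f rest)              ∎)
    where open ≤-Reasoning

prefixSum-minimal : ∀ f → Monotone f → (L : List ℕ) → Unique L → sumBelow f (length L) ≤ sum (map f L)
prefixSum-minimal f mono L u = proj₂ (distinctBelow f mono (suc (max 0 L)) L u (All.map s≤s (xs≤max 0 L)))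

minimum-≤ : ∀ {x} (l : List ℕ) → x ∈ l → minimum l ≤ x
minimum-≤ (x ∷ []) (here refl) = ≤-refl
minimum-≤ (x ∷ y ∷ ys) (here refl) = m⊓n≤m x _
minimum-≤ (x ∷ y ∷ ys) (there x∈) = ≤-trans (m⊓n≤n x _) (minimum-≤ (y ∷ ys) x∈)

minimum-∈ : ∀ x (l : List ℕ) → minimum (x ∷ l) ∈ x ∷ l
minimum-∈ x [] = here refl
minimum-∈ x (y ∷ ys) with ⊓-sel x (minimum (y ∷ ys))
... | inj₁ eq = here eq
... | inj₂ eq = there (subst (_∈ y ∷ ys) (sym eq) (minimum-∈ y ys))

minimum-scale : ∀ c (l : List ℕ) → minimum (map (c *_) l) ≡ c * minimum l
minimum-scale c [] = sym (*-zeroʳ c)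
minimum-scale c (x ∷ []) = refl
minimum-scale c (x ∷ y ∷ ys) = trans (cong (c * x ⊓_) (minimum-scale c (y ∷ ys))) (sym (*-distribˡ-⊓ c x _))

module Recurrence (pk qk : ℕ) (g : ℕ → ℕ) where
  H : ℕ → ℕ
  H n = headD (table pk qk g n)

  candidate-∈ : ∀ n s i → i ≤ n → pk * H (n ∸ i) + qk * g (s + i) ∈ cands pk qk g (table pk qk g n) s
  candidate-∈ zero s zero _ rewrite +-identityʳ s = here refl
  candidate-∈ (suc n) s zero _ rewrite +-identityʳ s = here refl
  candidate-∈ (suc n) s (suc i) (s≤s i≤n) rewrite +-suc s i = there (candidate-∈ n (suc s) i i≤n)

  ∈-candidate : ∀ n s {x} → x ∈ cands pk qk g (table pk qk g n) s →
                Σ ℕ λ i → i ≤ n × x ≡ pk * H (n ∸ i) + qk * g (s + i)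
  ∈-candidate zero s (here refl) = 0 , z≤n , cong (λ z → pk * 0 + qk * g z) (sym (+-identityʳ s))
  ∈-candidate (suc n) s (here refl) = 0 , z≤n , cong (λ z → pk * H (suc n) + qk * g z) (sym (+-identityʳ s))
  ∈-candidate (suc n) s (there x∈) with i , i≤n , eq ← ∈-candidate n (suc s) x∈ =
    suc i , s≤s i≤n , trans eq (cong (λ z → pk * H (n ∸ i) + qk * g z) (sym (+-suc s i)))

  H-≤ : ∀ n t → 1 ≤ t → t ≤ suc n → H (suc n) ≤ pk * H (suc n ∸ t) + qk * g t
  H-≤ n (suc i) _ (s≤s i≤n) = minimum-≤ (cands pk qk g (table pk qk g n) 1) (candidate-∈ n 1 i i≤n)

  minimum-∈-cands : ∀ n → minimum (cands pk qk g (table pk qk g n) 1) ∈ cands pk qk g (table pk qk g n) 1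
  minimum-∈-cands zero = here refl
  minimum-∈-cands (suc n) = minimum-∈ _ (cands pk qk g (table pk qk g n) 2)

  H-attained : ∀ n → Σ ℕ λ t → 1 ≤ t × t ≤ suc n × H (suc n) ≡ pk * H (suc n ∸ t) + qk * g t
  H-attained n with i , i≤n , eq ← ∈-candidate n 1 (minimum-∈-cands n) = suc i , s≤s z≤n , s≤s i≤n , eq

prodFrom-snoc : ∀ f a m → prodFrom f a (suc m) ≡ prodFrom f a m * f (a + m)
prodFrom-snoc f a zero = trans (*-comm (f a) 1) (cong (λ z → 1 * f z) (sym (+-identityʳ a)))
prodFrom-snoc f a (suc m) = begin
  f a * prodFrom f (suc a) (suc m)             ≡⟨ cong (f a *_) (prodFrom-snoc f (suc a) m) ⟩
  f a * (prodFrom f (suc a) m * f (suc a + m)) ≡⟨ *-assoc (f a) _ _ ⟨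
  f a * prodFrom f (suc a) m * f (suc a + m)   ≡⟨ cong (λ z → f a * prodFrom f (suc a) m * f z) (sym (+-suc a m)) ⟩
  f a * prodFrom f (suc a) m * f (a + suc m)   ∎
  where open ≡-Reasoning

headD-scale : ∀ c (l : List ℕ) → headD (map (c *_) l) ≡ c * headD l
headD-scale c [] = sym (*-zeroʳ c)
headD-scale c (x ∷ l) = refl

candidate-scale : ∀ pk qk Q x y → pk * (Q * qk * x) + qk * (Q * y) ≡ Q * qk * (pk * x + 1 * y)
candidate-scale = solve-∀

table-scale : ∀ pk qk Q (g g' : ℕ → ℕ) → (∀ t → g t ≡ Q * g' t) →
              ∀ n → table pk qk g n ≡ map (Q * qk *_) (table pk 1 g' n)
table-scale pk qk Q g g' g≡Qg' zero = cong (_∷ []) (sym (*-zeroʳ (Q * qk)))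
table-scale pk qk Q g g' g≡Qg' (suc n) rewrite table-scale pk qk Q g g' g≡Qg' n =
  cong (_∷ _) (trans (cong minimum (cands-scale (table pk 1 g' n) 1))
                     (minimum-scale (Q * qk) (cands pk 1 g' (table pk 1 g' n) 1)))
  where
  cands-scale : ∀ l s → cands pk qk g (map (Q * qk *_) l) s ≡ map (Q * qk *_) (cands pk 1 g' l s)
  cands-scale [] s = refl
  cands-scale (x ∷ l) s rewrite g≡Qg' s = cong₂ _∷_ (candidate-scale pk qk Q x (g' s)) (cands-scale l (suc s))

G3-scale : ∀ p q n → G3 p q n ≡ q 3 * G3 p (const 1) n
G3-scale p q zero = sym (*-zeroʳ (q 3))
G3-scale p q (suc n) rewrite G3-scale p q n = step (p 3) (q 3) (G3 p (const 1) n)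
  where
  step : ∀ a b x → a * (b * x) + b ≡ b * (a * x + 1)
  step = solve-∀

G-scale : ∀ p q m n → G p q (3 + m) n ≡ prodQ q (3 + m) * G p (const 1) (3 + m) n
G-scale p q zero n = trans (G3-scale p q n) (cong (_* G3 p (const 1) n) (sym (*-identityʳ (q 3))))
G-scale p q (suc m) n = begin
  headD (table (p (4 + m)) (q (4 + m)) (G p q (3 + m)) n)
    ≡⟨ cong headD (table-scale (p (4 + m)) (q (4 + m)) (prodQ q (3 + m)) _ _ (G-scale p q m) n) ⟩
  headD (map (prodQ q (3 + m) * q (4 + m) *_) (table (p (4 + m)) 1 (G p (const 1) (3 + m)) n))
    ≡⟨ headD-scale (prodQ q (3 + m) * q (4 + m)) (table (p (4 + m)) 1 (G p (const 1) (3 + m)) n) ⟩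
  prodQ q (3 + m) * q (4 + m) * G p (const 1) (4 + m) n
    ≡⟨ cong (_* G p (const 1) (4 + m) n) (prodFrom-snoc q 3 (suc m)) ⟨
  prodQ q (4 + m) * G p (const 1) (4 + m) n ∎
  where open ≡-Reasoning

-- Exponent tuples of length m+1 split by their last exponent: either it is 0,
-- i.e. the tuple is w ∷ʳ 0, or the tuple is `bumpLast w` for a tuple w of the same length.
bumpLast : ∀ {m} → Vec ℕ (suc m) → Vec ℕ (suc m)
bumpLast (x ∷ []) = suc x ∷ []
bumpLast (x ∷ y ∷ ys) = x ∷ bumpLast (y ∷ ys)

lastExp : ∀ {m} → Vec ℕ (suc m) → ℕ
lastExp (x ∷ []) = x
lastExp (x ∷ y ∷ ys) = lastExp (y ∷ ys)

lastExp-∷ʳ0 : ∀ {m} (w : Vec ℕ m) → lastExp (w ∷ʳ 0) ≡ 0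
lastExp-∷ʳ0 [] = refl
lastExp-∷ʳ0 (x ∷ []) = refl
lastExp-∷ʳ0 (x ∷ y ∷ ys) = lastExp-∷ʳ0 (y ∷ ys)

lastExp-bumpLast : ∀ {m} (w : Vec ℕ (suc m)) → lastExp (bumpLast w) ≡ suc (lastExp w)
lastExp-bumpLast (x ∷ []) = refl
lastExp-bumpLast (x ∷ y ∷ []) = refl
lastExp-bumpLast (x ∷ y ∷ z ∷ zs) = lastExp-bumpLast (y ∷ z ∷ zs)

lastCases : ∀ {m} (v : Vec ℕ (suc m)) → (∃ λ w → v ≡ w ∷ʳ 0) ⊎ (∃ λ w → v ≡ bumpLast w)
lastCases (zero ∷ []) = inj₁ ([] , refl)
lastCases (suc a ∷ []) = inj₂ (a ∷ [] , refl)
lastCases (x ∷ y ∷ ys) with lastCases (y ∷ ys)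
... | inj₁ (w , eq) = inj₁ (x ∷ w , cong (x ∷_) eq)
... | inj₂ (z ∷ zs , eq) = inj₂ (x ∷ z ∷ zs , cong (x ∷_) eq)

bumpLast-injective : ∀ {m} {v w : Vec ℕ (suc m)} → bumpLast v ≡ bumpLast w → v ≡ w
bumpLast-injective {v = x ∷ []} {y ∷ []} refl = refl
bumpLast-injective {v = x ∷ x′ ∷ xs} {y ∷ y′ ∷ ys} eq with refl , eq′ ← ∷-injective eq =
  cong (x ∷_) (bumpLast-injective eq′)

∷ʳ0≢bumpLast : ∀ {m} (v : Vec ℕ m) (w : Vec ℕ (suc m)) → v ∷ʳ 0 ≢ bumpLast w
∷ʳ0≢bumpLast [] (x ∷ []) ()
∷ʳ0≢bumpLast (x ∷ v) (y ∷ z ∷ zs) eq = ∷ʳ0≢bumpLast v (z ∷ zs) (proj₂ (∷-injective eq))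

merge : ∀ {m} → List (Vec ℕ m) → List (Vec ℕ (suc m)) → List (Vec ℕ (suc m))
merge A B = map (_∷ʳ 0) A ++ map bumpLast B

decompose : ∀ {m} (L : List (Vec ℕ (suc m))) → Σ (List (Vec ℕ m)) λ A → Σ (List (Vec ℕ (suc m))) λ B → L ↭ merge A B
decompose [] = [] , [] , ↭-refl
decompose (v ∷ L) with A , B , L↭ ← decompose L | lastCases v
... | inj₁ (w , refl) = w ∷ A , B , prep _ L↭
... | inj₂ (w , refl) = A , w ∷ B , ↭-trans (prep _ L↭) (↭-sym (shift (bumpLast w) (map (_∷ʳ 0) A) (map bumpLast B)))

merge-length : ∀ {m} (A : List (Vec ℕ m)) B → length (merge A B) ≡ length A + length B
merge-length A B = trans (length-++ (map (_∷ʳ 0) A)) (cong₂ _+_ (length-map _ A) (length-map bumpLast B))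

-- The weight Σ (1 + last exponent) strictly decreases from merge A B to B unless both are empty.
weight : ∀ {m} → List (Vec ℕ (suc m)) → ℕ
weight L = sum (map (suc ∘ lastExp) L)

bumped-weight : ∀ {m} (B : List (Vec ℕ (suc m))) → weight (map bumpLast B) ≡ length B + weight B
bumped-weight [] = refl
bumped-weight (w ∷ B) rewrite lastExp-bumpLast w | bumped-weight B = rearrange (lastExp w) (length B) (weight B)
  where
  rearrange : ∀ e b W → suc (suc e) + (b + W) ≡ suc b + (suc e + W)
  rearrange = solve-∀

merge-weight : ∀ {m} (A : List (Vec ℕ m)) B → weight (merge A B) ≡ length A + (length B + weight B)
merge-weight [] B = bumped-weight B
merge-weight (w ∷ A) B rewrite lastExp-∷ʳ0 w = cong suc (merge-weight A B)

unique-++⁻ : ∀ {A : Set} (xs : List A) {ys} → Unique (xs ++ ys) → Unique xs × Unique ys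
unique-++⁻ [] u = [] , u
unique-++⁻ (x ∷ xs) (x∉ ∷ u) = Product.map₁ (++⁻ˡ xs x∉ ∷_) (unique-++⁻ xs u)

merge-unique⁺ : ∀ {m} {A : List (Vec ℕ m)} {B} → Unique A → Unique B → Unique (merge A B)
merge-unique⁺ {A = A} {B} uA uB =
  UP.++⁺ (UP.map⁺ (∷ʳ-injectiveˡ _ _) uA) (UP.map⁺ bumpLast-injective uB) disjoint
  where
  disjoint : Disjoint (map (_∷ʳ 0) A) (map bumpLast B)
  disjoint (v∈A , v∈B) with ∈-map⁻ (_∷ʳ 0) v∈A | ∈-map⁻ bumpLast v∈B
  ... | w , _ , refl | w′ , _ , eq = ∷ʳ0≢bumpLast w w′ eq

merge-unique⁻ : ∀ {m} (A : List (Vec ℕ m)) {B} → Unique (merge A B) → Unique A × Unique B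
merge-unique⁻ A u = Product.map UP.map⁻ UP.map⁻ (unique-++⁻ (map (_∷ʳ 0) A) u)

module Values (p : ℕ → ℕ) where
  valueSum : ∀ {m} → List (Vec ℕ m) → ℕ
  valueSum L = sum (map (powProd p 3) L)

  powProd-∷ʳ0 : ∀ {m} i (w : Vec ℕ m) → powProd p i (w ∷ʳ 0) ≡ powProd p i w
  powProd-∷ʳ0 i [] = refl
  powProd-∷ʳ0 i (x ∷ w) = cong (p i ^ x *_) (powProd-∷ʳ0 (suc i) w)

  powProd-bumpLast : ∀ {m} i (w : Vec ℕ (suc m)) → powProd p i (bumpLast w) ≡ p (i + m) * powProd p i w
  powProd-bumpLast i (x ∷ []) rewrite +-identityʳ i = *-assoc (p i) (p i ^ x) 1
  powProd-bumpLast {suc m} i (x ∷ y ∷ ys) rewrite powProd-bumpLast (suc i) (y ∷ ys) | +-suc i m =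
    x*[y*z]≡y*[x*z] (p i ^ x) (p (suc (i + m))) (powProd p (suc i) (y ∷ ys))
    where
    x*[y*z]≡y*[x*z] : ∀ x y z → x * (y * z) ≡ y * (x * z)
    x*[y*z]≡y*[x*z] = solve-∀

  merge-valueSum : ∀ {m} (A : List (Vec ℕ m)) B → valueSum (merge A B) ≡ valueSum A + p (3 + m) * valueSum B
  merge-valueSum {m} A B = begin
    valueSum (merge A B)
      ≡⟨ sumMap-++ (powProd p 3) (map (_∷ʳ 0) A) (map bumpLast B) ⟩
    sum (map (powProd p 3) (map (_∷ʳ 0) A)) + sum (map (powProd p 3) (map bumpLast B))
      ≡⟨ cong₂ _+_ (sumMap-map (powProd p 3) (_∷ʳ 0) (powProd-∷ʳ0 3) A)
                   (sumMap-map (powProd p 3) bumpLast (powProd-bumpLast 3) B) ⟩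
    valueSum A + sum (map (λ w → p (3 + m) * powProd p 3 w) B)
      ≡⟨ cong (valueSum A +_) (sumMap-scale (p (3 + m)) (powProd p 3) B) ⟩
    valueSum A + p (3 + m) * valueSum B ∎
    where open ≡-Reasoning

module Levels (p : ℕ → ℕ) (p≥1 : ∀ i → 3 ≤ i → 1 ≤ p i) where
  open Values p

  LowerBound : ℕ → (ℕ → ℕ) → Set
  LowerBound m g = ∀ (L : List (Vec ℕ (suc m))) → Unique L → g (length L) ≤ valueSum L

  Attained : ℕ → (ℕ → ℕ) → Set
  Attained m g = ∀ n → Σ (List (Vec ℕ (suc m))) λ L → Unique L × length L ≡ n × valueSum L ≤ g n

  value₃ : ℕ → ℕ
  value₃ a = powProd p 3 (a ∷ [])

  value₃-monotone : Monotone value₃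
  value₃-monotone i j i≤j = *-monoˡ-≤ 1 (^-monoʳ-≤ (p 3) {{>-nonZero (p≥1 3 ≤-refl)}} i≤j)

  G3-sumBelow : ∀ n → G3 p (const 1) n ≡ sumBelow value₃ n
  G3-sumBelow zero = refl
  G3-sumBelow (suc n) = begin
    p 3 * G3 p (const 1) n + 1     ≡⟨ cong (λ z → p 3 * z + 1) (G3-sumBelow n) ⟩
    p 3 * sumBelow value₃ n + 1    ≡⟨ +-comm _ 1 ⟩
    1 + p 3 * sumBelow value₃ n    ≡⟨ cong (1 +_) (sumBelow-scale (p 3) value₃ (value₃ ∘ suc) (λ a → *-assoc (p 3) (p 3 ^ a) 1) n) ⟨
    sumBelow value₃ (suc n)        ∎
    where open ≡-Reasoning

  lowerBound-base : LowerBound 0 (G3 p (const 1))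
  lowerBound-base L u = begin
    G3 p (const 1) (length L)          ≡⟨ G3-sumBelow (length L) ⟩
    sumBelow value₃ (length L)         ≡⟨ cong (sumBelow value₃) (length-map head L) ⟨
    sumBelow value₃ (length (map head L))
      ≤⟨ prefixSum-minimal value₃ value₃-monotone (map head L) (UP.map⁺ head-injective u) ⟩
    sum (map value₃ (map head L))      ≡⟨ sumMap-map value₃ head (λ { (a ∷ []) → refl }) L ⟩
    valueSum L                         ∎
    where
    open ≤-Reasoning
    head-injective : ∀ {v w : Vec ℕ 1} → head v ≡ head w → v ≡ w
    head-injective {a ∷ []} {b ∷ []} refl = refl

  attained-base : Attained 0 (G3 p (const 1))
  attained-base n =
    map (_∷ []) (upTo n) ,
    UP.map⁺ (λ { refl → refl }) (UP.upTo⁺ n) ,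
    trans (length-map _ (upTo n)) (length-upTo n) ,
    ≤-reflexive (begin
      valueSum (map (_∷ []) (upTo n)) ≡⟨ sumMap-map (powProd p 3) (_∷ []) (λ _ → refl) (upTo n) ⟩
      sumFirst value₃ n               ≡⟨ sumFirst≡sumBelow value₃ n ⟩
      sumBelow value₃ n               ≡⟨ G3-sumBelow n ⟨
      G3 p (const 1) n                ∎)
    where open ≡-Reasoning

  module Step (m : ℕ) (g : ℕ → ℕ) where
    pk : ℕ
    pk = p (4 + m)

    open Recurrence pk 1 g

    -- The recurrence bound also holds for t = 0, because p_{4+m} ≥ 1.
    H-≤-split : ∀ n t → t ≤ n → H n ≤ pk * H (n ∸ t) + g t
    H-≤-split n zero _ = ≤-trans (m≤n*m (H n) pk {{>-nonZero (p≥1 (4 + m) (s≤s (s≤s (s≤s z≤n))))}}) (m≤m+n _ (g 0))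
    H-≤-split (suc n) (suc t) t≤n =
      subst (H (suc n) ≤_) (cong (pk * H (n ∸ t) +_) (*-identityˡ (g (suc t)))) (H-≤ n (suc t) (s≤s z≤n) t≤n)

    -- Splitting n distinct tuples by whether the last exponent is zero:
    -- H(|A|+|B|) ≤ p_{4+m}·H(|B|) + g(|A|) ≤ p_{4+m}·valueSum B + valueSum A.
    merge-bound : LowerBound m g → ∀ A B → Unique A → H (length B) ≤ valueSum B →
                  H (length (merge A B)) ≤ valueSum (merge A B)
    merge-bound lowerBound A B uA HB≤ = begin
      H (length (merge A B))                        ≡⟨ cong H (merge-length A B) ⟩
      H (length A + length B)                       ≤⟨ H-≤-split _ (length A) (m≤m+n _ _) ⟩
      pk * H (length A + length B ∸ length A) + g (length A)
                                                    ≡⟨ cong (λ z → pk * H z + g (length A)) (m+n∸m≡n (length A) _) ⟩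
      pk * H (length B) + g (length A)              ≤⟨ +-mono-≤ (*-monoʳ-≤ pk HB≤) (lowerBound A uA) ⟩
      pk * valueSum B + valueSum A                  ≡⟨ +-comm _ (valueSum A) ⟩
      valueSum A + pk * valueSum B                  ≡⟨ merge-valueSum A B ⟨
      valueSum (merge A B)                          ∎
      where open ≤-Reasoning

    -- The recursion into B terminates since weight B < weight L for nonempty L.
    lowerBound-acc : LowerBound m g → ∀ L → Acc _<_ (weight L) → Unique L → H (length L) ≤ valueSum L
    lowerBound-acc lowerBound [] _ _ = z≤n
    lowerBound-acc lowerBound L@(_ ∷ _) (acc rec) u with A , B , L↭ ← decompose L =
      subst₂ (λ n s → H n ≤ s) (sym (↭-length L↭)) (sym (sumMap-↭ (powProd p 3) L↭))
        (merge-bound lowerBound A B uA (lowerBound-acc lowerBound B (rec weightB<) uB))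
      where
      uA×uB = merge-unique⁻ A (unique-↭ L↭ u)
      uA = proj₁ uA×uB
      uB = proj₂ uA×uB
      weightB< : weight B < weight L
      weightB< = begin-strict
        weight B                              <⟨ m<n+m (weight B) (subst (0 <_) (trans (↭-length L↭) (merge-length A B)) z<s) ⟩
        length A + length B + weight B        ≡⟨ +-assoc (length A) (length B) (weight B) ⟩
        length A + (length B + weight B)      ≡⟨ merge-weight A B ⟨
        weight (merge A B)                    ≡⟨ sumMap-↭ (suc ∘ lastExp) L↭ ⟨
        weight L                              ∎
        where open ≤-Reasoning

    lowerBound-step : LowerBound m g → LowerBound (suc m) H
    lowerBound-step lowerBound L = lowerBound-acc lowerBound L (<-wellFounded (weight L))

    -- Strong induction on n: H n = p_{4+m}·H(n-t) + g t is realised by merging an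
    -- optimal set of t shorter tuples with a (bumped) optimal set for n-t.
    attained-step : Attained m g → Attained (suc m) H
    attained-step attainedPrev = <-rec _ realise
      where
      realise : ∀ n → (∀ {k} → k < n → Σ (List (Vec ℕ (2 + m))) λ L → Unique L × length L ≡ k × valueSum L ≤ H k) →
                Σ (List (Vec ℕ (2 + m))) λ L → Unique L × length L ≡ n × valueSum L ≤ H n
      realise zero _ = [] , [] , refl , z≤n
      realise (suc n) smaller
        with t , 1≤t , t≤1+n , H≡ ← H-attained n
        with A , uA , |A|≡t , vA≤ ← attainedPrev t
        with B , uB , |B|≡ , vB≤ ← smaller (∸-monoʳ-< 1≤t t≤1+n) =
        merge A B ,
        merge-unique⁺ uA uB ,
        trans (merge-length A B) (trans (cong₂ _+_ |A|≡t |B|≡) (m+[n∸m]≡n t≤1+n)) ,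
        (begin
          valueSum (merge A B)              ≡⟨ merge-valueSum A B ⟩
          valueSum A + pk * valueSum B      ≤⟨ +-mono-≤ vA≤ (*-monoʳ-≤ pk vB≤) ⟩
          g t + pk * H (suc n ∸ t)          ≡⟨ +-comm (g t) _ ⟩
          pk * H (suc n ∸ t) + g t          ≡⟨ cong (pk * H (suc n ∸ t) +_) (*-identityˡ (g t)) ⟨
          pk * H (suc n ∸ t) + 1 * g t      ≡⟨ H≡ ⟨
          H (suc n)                         ∎)
        where open ≤-Reasoning

  K : ℕ → ℕ → ℕ
  K m = G p (const 1) (3 + m)

  lowerBound : ∀ m → LowerBound m (K m)
  lowerBound zero = lowerBound-base
  lowerBound (suc m) = Step.lowerBound-step m (K m) (lowerBound m)

  attained : ∀ m → Attained m (K m)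
  attained zero = attained-base
  attained (suc m) = Step.attained-step m (K m) (attained m)

  value-positive : ∀ {k} i → 3 ≤ i → (w : Vec ℕ k) → 1 ≤ powProd p i w
  value-positive i 3≤i [] = ≤-refl
  value-positive i 3≤i (a ∷ w) =
    *-mono-≤ (m^n>0 (p i) {{>-nonZero (p≥1 i 3≤i)}} a) (value-positive (suc i) (m≤n⇒m≤1+n 3≤i) w)

  length≤valueSum : ∀ {k} (L : List (Vec ℕ k)) → length L ≤ valueSum L
  length≤valueSum [] = z≤n
  length≤valueSum (w ∷ L) = +-mono-≤ (value-positive 3 ≤-refl w) (length≤valueSum L)

  axis : ∀ {k} → Fin k → ℕ → Vec ℕ k
  axis {k} j a = replicate k 0 [ j ]≔ a

  zeros-value : ∀ {k} i → powProd p i (replicate k 0) ≡ 1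
  zeros-value {zero} i = refl
  zeros-value {suc k} i = trans (*-identityˡ (powProd p (suc i) (replicate k 0))) (zeros-value {k} (suc i))

  axis-value : ∀ {k} i (j : Fin k) a → powProd p i (axis j a) ≡ p (i + toℕ j) ^ a
  axis-value {suc k} i zero a = begin
    p i ^ a * powProd p (suc i) (replicate k 0) ≡⟨ cong (p i ^ a *_) (zeros-value {k} (suc i)) ⟩
    p i ^ a * 1                                  ≡⟨ *-identityʳ _ ⟩
    p i ^ a                                      ≡⟨ cong (λ z → p z ^ a) (+-identityʳ i) ⟨
    p (i + 0) ^ a                                ∎
    where open ≡-Reasoning
  axis-value i (suc j) a = begin
    1 * powProd p (suc i) (axis j a) ≡⟨ *-identityˡ (powProd p (suc i) (axis j a)) ⟩
    powProd p (suc i) (axis j a)     ≡⟨ axis-value (suc i) j a ⟩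
    p (suc i + toℕ j) ^ a            ≡⟨ cong (λ z → p z ^ a) (+-suc i (toℕ j)) ⟨
    p (i + suc (toℕ j)) ^ a          ∎
    where open ≡-Reasoning

  axis-injective : ∀ {k} (j : Fin k) {a b} → axis j a ≡ axis j b → a ≡ b
  axis-injective {k} j {a} {b} eq =
    trans (sym (lookup∘updateAt j (replicate k 0))) (trans (cong (λ v → lookup v j) eq) (lookup∘updateAt j (replicate k 0)))

  -- If p_{3+j} = 1, the n axis tuples along position j all have value 1, so the
  -- least value sum of n distinct tuples is n.
  minimum-degenerate : ∀ m g → LowerBound m g → Attained m g →
                       (j : Fin (suc m)) → p (3 + toℕ j) ≡ 1 → ∀ n → g n ≡ n
  minimum-degenerate m g lowerBound attained j p≡1 n = ≤-antisym g≤n n≤g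
    where
    axisTuples : List (Vec ℕ (suc m))
    axisTuples = map (axis j) (upTo n)

    g≤n : g n ≤ n
    g≤n = begin
      g n                                ≡⟨ cong g (trans (length-map (axis j) (upTo n)) (length-upTo n)) ⟨
      g (length axisTuples)              ≤⟨ lowerBound axisTuples (UP.map⁺ (axis-injective j) (UP.upTo⁺ n)) ⟩
      valueSum axisTuples                ≡⟨ sumMap-map (powProd p 3) (axis j) axis-value-one (upTo n) ⟩
      sumFirst (const 1) n               ≡⟨ sumFirst≡sumBelow (const 1) n ⟩
      sumBelow (const 1) n               ≡⟨ sumBelow-ones (const 1) (λ _ → refl) n ⟩
      n                                  ∎
      where
      open ≤-Reasoning
      axis-value-one : ∀ a → powProd p 3 (axis j a) ≡ 1
      axis-value-one a = trans (axis-value 3 j a) (trans (cong (_^ a) p≡1) (^-zeroˡ a))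

    n≤g : n ≤ g n
    n≤g with L , _ , |L|≡n , L≤g ← attained n = subst (_≤ g n) |L|≡n (≤-trans (length≤valueSum L) L≤g)

  minimum-sorted : ∀ m g → LowerBound m g → Attained m g →
                   (e : ℕ → Vec ℕ (suc m)) → Injective _≡_ _≡_ e → Surjective _≡_ _≡_ e →
                   (u : ℕ → ℕ) → (∀ j → u j ≡ powProd p 3 (e j)) → Monotone u →
                   ∀ n → g n ≡ sumFirst u n
  minimum-sorted m g lowerBound attained e e-inj e-surj u u≡ u-mono n = ≤-antisym g≤ ≤g
    where
    firstTuples : List (Vec ℕ (suc m))
    firstTuples = map e (upTo n)

    g≤ : g n ≤ sumFirst u n
    g≤ = begin
      g n                          ≡⟨ cong g (trans (length-map e (upTo n)) (length-upTo n)) ⟨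
      g (length firstTuples)       ≤⟨ lowerBound firstTuples (UP.map⁺ e-inj (UP.upTo⁺ n)) ⟩
      valueSum firstTuples         ≡⟨ sumMap-map (powProd p 3) e (sym ∘ u≡) (upTo n) ⟩
      sumFirst u n                 ∎
      where open ≤-Reasoning

    index : Vec ℕ (suc m) → ℕ
    index τ = proj₁ (e-surj τ)

    e∘index : ∀ τ → e (index τ) ≡ τ
    e∘index τ = proj₂ (e-surj τ) refl

    index-injective : ∀ {σ τ} → index σ ≡ index τ → σ ≡ τ
    index-injective {σ} {τ} eq = trans (sym (e∘index σ)) (trans (cong e eq) (e∘index τ))

    ≤g : sumFirst u n ≤ g n
    ≤g with T , uT , |T|≡n , T≤g ← attained n = begin
      sumFirst u n                     ≡⟨ sumFirst≡sumBelow u n ⟩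
      sumBelow u n                     ≡⟨ cong (sumBelow u) (trans (length-map index T) |T|≡n) ⟨
      sumBelow u (length (map index T)) ≤⟨ prefixSum-minimal u u-mono (map index T) (UP.map⁺ index-injective uT) ⟩
      sum (map u (map index T))        ≡⟨ sumMap-map u index (λ τ → trans (u≡ (index τ)) (cong (powProd p 3) (e∘index τ))) T ⟩
      valueSum T                       ≤⟨ T≤g ⟩
      g n                              ∎
      where open ≤-Reasoning

position : ∀ m i₀ → 3 ≤ i₀ → i₀ ≤ 3 + m → Σ (Fin (suc m)) λ j → 3 + toℕ j ≡ i₀
position m i₀ 3≤i₀ i₀≤3+m =
  fromℕ< (s≤s (∸-monoˡ-≤ 3 i₀≤3+m)) ,
  trans (cong (3 +_) (toℕ-fromℕ< (s≤s (∸-monoˡ-≤ 3 i₀≤3+m)))) (m+[n∸m]≡n 3≤i₀)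

theorem1 : (p q : ℕ → ℕ) → (∀ i → 3 ≤ i → 1 ≤ p i) → (∀ i → 3 ≤ i → 1 ≤ q i) →
    (k : ℕ) → 3 ≤ k → (u : ℕ → ℕ) → IsUSeq p k u →
    (n : ℕ) → 1 ≤ n → G p q k n ≡ prodQ q k * sumFirst u n
theorem1 p q p≥1 _ (suc zero) (s≤s ()) u u-seq n _
theorem1 p q p≥1 _ (suc (suc zero)) (s≤s (s≤s ())) u u-seq n _
theorem1 p q p≥1 _ (suc (suc (suc m))) _ u u-seq n _ =
  trans (G-scale p q m n) (cong (prodQ q (3 + m) *_) (K≡sumFirst u-seq))
  where
  open Levels p p≥1

  K≡sumFirst : IsUSeq p (3 + m) u → K m n ≡ sumFirst u n
  K≡sumFirst (inj₁ ((i₀ , 3≤i₀ , i₀≤k , p≡1) , u≡1))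
    with j , 3+j≡i₀ ← position m i₀ 3≤i₀ i₀≤k =
    trans (minimum-degenerate m (K m) (lowerBound m) (attained m) j (trans (cong p 3+j≡i₀) p≡1) n)
          (sym (trans (sumFirst≡sumBelow u n) (sumBelow-ones u u≡1 n)))
  K≡sumFirst (inj₂ (_ , e , e-inj , e-surj , u≡ , u-mono)) =
    minimum-sorted m (K m) (lowerBound m) (attained m) e e-inj e-surj u u≡ u-mono n
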